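{- Let $a,b,d$ be three pairwise coprime positive integers such that $d\notin\langle a,b\rangle$ and $a<b$, and let $S=\langle a,b\rangle/d$. Case 1: if $(a-1)(b-1)\equiv1\pmod d$, then $S$ is symmetric (its type is $1$) and $f(S)=\frac{f(\langle a,b\rangle)}{d}=\frac{ab-a-b}{d}$. Case 2: if $a\equiv1\pmod d$, then $\mathrm{PF}(S)=\frac{(a-1)b}{d}-\big(\mathrm{Irr}(S)\setminus\{b\}\big)$. Case 3: if $b\equiv1\pmod d$, then $\mathrm{PF}(S)=\frac{(b-1)a}{d}-\big(\mathrm{Irr}(S)\setminus\{a\}\big)$. In Cases 2 and 3, $t(S)=e(S)-1$.
   Context: $\langle a,b\rangle=\{xa+yb:x,y\in\mathbb{N}\}$; $S/d=\{x\in\mathbb{N}:dx\in S\}$. For a numerical semigroup $S$: $\mathrm{Irr}(S)$ is its minimal generating set, $e(S)=\#\mathrm{Irr}(S)$; $\mathrm{PF}(S)=\{x\in\mathbb{Z}\setminus S: x+s\in S \text{ for all nonzero } s\in S\}$, $t(S)=\#\mathrm{PF}(S)$ (the type); $f(S)=\max(\mathbb{Z}\setminus S)$; $S$ is symmetric if $\#\{s\in S: s<f(S)\}=\#(\mathbb{N}\setminus S)$. For $x\in\mathbb{Z}$ and $A\subseteq\mathbb{Z}$, $x-A=\{x-y:y\in A\}$. -}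

module Defs where

open import Data.Nat using (ℕ; zero; suc; _+_; _*_)
open import Data.Integer as ℤ using (ℤ; +_; -[1+_])
open import Data.Product using (Σ; ∃₂; _×_)
open import Data.List using (List; length)
open import Data.List.Relation.Unary.Unique.Propositional using (Unique)
open import Data.List.Membership.Propositional using (_∈_)
open import Data.Empty using (⊥)
open import Relation.Nullary using (¬_)
open import Relation.Binary.PropositionalEquality using (_≡_; _≢_)
open import Function.Bundles using (_⇔_)

Gen2 : ℕ → ℕ → ℕ → Set
Gen2 a b n = ∃₂ λ x y → x * a + y * b ≡ n

Quot : (ℕ → Set) → ℕ → ℕ → Set
Quot S d x = S (d * x)

InZ : (ℕ → Set) → ℤ → Set
InZ S (+ n)    = S n
InZ S -[1+ n ] = ⊥

-- Irr(S): minimal generating set of a numerical semigroup, i.e. S* \ (S* + S*)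
Irr : (ℕ → Set) → ℕ → Set
Irr S x = S x × x ≢ 0 ×
  ¬ (∃₂ λ y z → S y × S z × y ≢ 0 × z ≢ 0 × y + z ≡ x)

PF : (ℕ → Set) → ℤ → Set
PF S x = ¬ InZ S x × (∀ s → S s → s ≢ 0 → InZ S (x ℤ.+ + s))

IsFrobenius : (ℕ → Set) → ℤ → Set
IsFrobenius S f = ¬ InZ S f × (∀ z → f ℤ.< z → InZ S z)

HasCard : (ℕ → Set) → ℕ → Set
HasCard P n = Σ (List ℕ) λ L → Unique L × (∀ x → (x ∈ L) ⇔ P x) × length L ≡ n

HasCardℤ : (ℤ → Set) → ℕ → Set
HasCardℤ P n = Σ (List ℤ) λ L → Unique L × (∀ x → (x ∈ L) ⇔ P x) × length L ≡ n

Symmetric : (ℕ → Set) → Set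
Symmetric S = Σ ℤ λ f → IsFrobenius S f × Σ ℕ λ n →
  HasCard (λ s → S s × + s ℤ.< f) n × HasCard (λ x → ¬ S x) n

Type : (ℕ → Set) → ℕ → Set
Type S t = HasCardℤ (PF S) t

EmbDim : (ℕ → Set) → ℕ → Set
EmbDim S e = HasCard (Irr S) e

-- Since gcd(A, B) = 1, every integer w has a unique normal form w = u A + v B with
-- 0 ≤ v < A, and w ∈ ⟨A,B⟩ exactly when u ≥ 0.  So z ∈ S = ⟨A,B⟩/d iff the A-coefficient
-- α z of d z is nonnegative.  If d C = K A + (A - 1) B then α (C - z) = K - α z.
-- Case 1: d F = -A + (A - 1) B, so z ↦ F - z exchanges S and its complement, which makes
-- S symmetric with Frobenius number F and PF(S) = {F}.
-- Case 2: d c = (A - 1) B, so α (c - z) = - α z.  For an irreducible y ≠ B (i.e. α y > 0),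
-- if c - y + s ∉ S then y - s ∈ S, so s = y.  Conversely, if x is pseudo-Frobenius and
-- c - x = y₁ + y₂ in S, then x + y₁ = c - y₂ ∈ S forces α y₂ = 0 and likewise α y₁ = 0; the
-- positive α (c - x) can then only come from a carry, so α x = -B and, as A ≡ 1 (mod d),
-- the B-coefficient of d x is at most A - d.  Adding s₀ ∈ S with d s₀ = A + t₀ B, t₀ < d,
-- then leaves S.  Case 3 is Case 2 with a and b exchanged.

module Submission where

open import Defs
open import Data.Nat using (ℕ; _+_; _*_; _∸_; _<_; _%_; _/_; NonZero)
open import Data.Nat.Coprimality using (Coprime)
open import Data.Integer as ℤ using (ℤ; +_)
open import Data.Product using (Σ; ∃; _×_)
open import Relation.Nullary using (¬_)
open import Relation.Binary.PropositionalEquality using (_≡_; _≢_)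
open import Function.Bundles using (_⇔_)

open import Data.Empty using (⊥)
open import Data.Integer using (-[1+_]; +[1+_]; 0ℤ; 1ℤ; -1ℤ; _⊖_)
  renaming (_+_ to _+ᶻ_; _-_ to _-ᶻ_; _*_ to _*ᶻ_; -_ to -ᶻ_; _≤_ to _≤ᶻ_; _<_ to _<ᶻ_)
import Data.Integer.Coprimality as ℤCop
import Data.Integer.Divisibility.Signed as ℤ∣
import Data.Integer.DivMod as ℤD
import Data.Integer.Properties as ℤP
open import Data.Integer.Tactic.RingSolver using (solve-∀)
open import Data.List using (List; []; _∷_; map; filter; upTo; length)
open import Data.List.Membership.Propositional using (_∈_)
open import Data.List.Membership.Propositional.Properties using (∈-filter⁻; ∈-filter⁺; ∈-upTo⁺; ∈-map⁻; ∈-map⁺)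
open import Data.List.Properties using (filter-reject; filter-accept; filter-all; length-map)
import Data.List.Relation.Unary.All as All
import Data.List.Relation.Unary.All.Properties as All
open import Data.List.Relation.Unary.AllPairs using ([]; _∷_)
open import Data.List.Relation.Unary.Any using (here; there)
open import Data.List.Relation.Unary.Unique.Propositional using (Unique)
import Data.List.Relation.Unary.Unique.Propositional.Properties as Unique
open import Data.Nat as ℕ using (zero; suc; _≤_; z≤n; s≤s)
open import Data.Nat.Coprimality as Cop using (coprime-Bézout; coprime-divisor)
import Data.Nat.DivMod as ℕD
open import Data.Nat.Divisibility as ℕ∣ using (_∣_; divides; >⇒∤)
open import Data.Nat.GCD using (module Bézout)
import Data.Nat.Properties as ℕP
import Data.Nat.Tactic.RingSolver as ℕSolver
open import Data.Product using (∃₂; _,_; proj₁; proj₂)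
open import Data.Sum using (_⊎_; inj₁; inj₂; [_,_])
open import Function.Base using (_∘_)
open import Function.Bundles using (mk⇔; Equivalence)
import Function.Properties.Equivalence as ⇔
open import Relation.Binary.PropositionalEquality using (refl; sym; trans; cong; cong₂; subst; module ≡-Reasoning)
open import Relation.Nullary using (¬?; contradiction; yes; no)
open import Relation.Nullary.Decidable using (_×-dec_; map′)
open import Relation.Unary using (Decidable)
open import Algebra.Properties.AbelianGroup ℤP.+-0-abelianGroup using (∙-cancelʳ)

pos-1+* : ∀ m n → + (1 + m * n) ≡ 1ℤ +ᶻ + m *ᶻ + n
pos-1+* m n = trans (ℤP.pos-+ 1 (m * n)) (cong (1ℤ +ᶻ_) (ℤP.pos-* m n))

pos-∸ : ∀ {m n} → n ≤ m → + (m ∸ n) ≡ + m -ᶻ + n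
pos-∸ {m} {n} n≤m = trans (sym (ℤP.⊖-≥ n≤m)) (sym (ℤP.m-n≡m⊖n m n))

nonneg-pos : ∀ {i} → 0ℤ ≤ᶻ i → i ≡ + ℤ.∣ i ∣
nonneg-pos 0≤i = sym (ℤP.0≤i⇒+∣i∣≡i 0≤i)

InZ⇒nonneg : ∀ {Q : ℕ → Set} z → InZ Q z → Σ ℕ λ n → z ≡ + n × Q n
InZ⇒nonneg (+ n) Qn = n , refl , Qn

multiple-below≡0 : ∀ {m k} → m ∣ k → k < m → k ≡ 0
multiple-below≡0 {k = zero}  _   _   = refl
multiple-below≡0 {k = suc _} m∣k k<m = contradiction m∣k (>⇒∤ k<m)

0≰pos*neg : ∀ d .{{_ : NonZero d}} n → ¬ 0ℤ ≤ᶻ + d *ᶻ -[1+ n ]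
0≰pos*neg (suc _) _ ()

0≤-1-i⇒0≰i : ∀ {i} → 0ℤ ≤ᶻ -1ℤ -ᶻ i → ¬ 0ℤ ≤ᶻ i
0≤-1-i⇒0≰i {+ zero}    ()
0≤-1-i⇒0≰i {+[1+ _ ]} ()
0≤-1-i⇒0≰i { -[1+ _ ]} _ ()

0≰i⇒0≤-1-i : ∀ {i} → ¬ 0ℤ ≤ᶻ i → 0ℤ ≤ᶻ -1ℤ -ᶻ i
0≰i⇒0≤-1-i {+ _}       0≰i = contradiction (ℤ.+≤+ z≤n) 0≰i
0≰i⇒0≤-1-i { -[1+ _ ]} _   = ℤ.+≤+ z≤n

0≤-i⇒i≤0 : ∀ {i} → 0ℤ ≤ᶻ -ᶻ i → i ≤ᶻ 0ℤ
0≤-i⇒i≤0 {i} 0≤-i = subst (_≤ᶻ 0ℤ) (ℤP.neg-involutive i) (ℤP.neg-mono-≤ 0≤-i)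

0≰-i⇒0≤i : ∀ {i} → ¬ 0ℤ ≤ᶻ -ᶻ i → 0ℤ ≤ᶻ i
0≰-i⇒0≤i {+ _}       _    = ℤ.+≤+ z≤n
0≰-i⇒0≤i { -[1+ _ ]} 0≰-i = contradiction (ℤ.+≤+ z≤n) 0≰-i

0≰i⇒-i≡1+k : ∀ {i} → ¬ 0ℤ ≤ᶻ i → ∃ λ k → -ᶻ i ≡ +[1+ k ]
0≰i⇒-i≡1+k {+ _}       0≰i = contradiction (ℤ.+≤+ z≤n) 0≰i
0≰i⇒-i≡1+k { -[1+ k ]} _   = k , refl

0≰-n+1 : ∀ {n} → 1 < n → ¬ 0ℤ ≤ᶻ -ᶻ + n +ᶻ 1ℤ
0≰-n+1 (s≤s (s≤s z≤n)) ()

Enumerates : {X : Set} → (X → Set) → List X → Set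
Enumerates Q L = Unique L × (∀ x → (x ∈ L) ⇔ Q x)

enumerate-bounded : ∀ {Q : ℕ → Set} (Q? : Decidable Q) N → (∀ n → Q n → n < N) →
  Enumerates Q (filter Q? (upTo N))
enumerate-bounded Q? N bound = Unique.filter⁺ Q? {upTo N} (Unique.upTo⁺ N) , λ x →
  mk⇔ (λ x∈ → proj₂ (∈-filter⁻ Q? {xs = upTo N} x∈)) (λ Qx → ∈-filter⁺ Q? (∈-upTo⁺ (bound x Qx)) Qx)

map-unique : ∀ {X Y : Set} (g : X → Y) {xs : List X} →
  (∀ {x y} → x ∈ xs → y ∈ xs → g x ≡ g y → x ≡ y) → Unique xs → Unique (map g xs)
map-unique g {[]}     _   []           = []
map-unique g {x ∷ xs} inj (x∉xs ∷ !xs) =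
  All.map⁺ (All.tabulate λ y∈xs gx≡gy → All.lookup x∉xs y∈xs (inj (here refl) (there y∈xs) gx≡gy))
  ∷ map-unique g (λ x∈ y∈ → inj (there x∈) (there y∈)) !xs

length-filter-≢ : ∀ b {xs} → Unique xs → b ∈ xs → suc (length (filter (λ y → ¬? (y ℕ.≟ b)) xs)) ≡ length xs
length-filter-≢ b {x ∷ xs} (x∉xs ∷ _) (here refl) =
  cong suc (trans (cong length (filter-reject (λ y → ¬? (y ℕ.≟ b)) {x} {xs} (λ b≢b → b≢b refl)))
                  (cong length (filter-all (λ y → ¬? (y ℕ.≟ b)) (All.map (λ b≢y y≡b → b≢y (sym y≡b)) x∉xs))))
length-filter-≢ b {x ∷ xs} (x∉xs ∷ !xs) (there b∈xs) with x ℕ.≟ b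
... | yes refl = contradiction refl (All.lookup x∉xs b∈xs)
... | no x≢b   = cong suc (trans (cong length (filter-accept (λ y → ¬? (y ℕ.≟ b)) {x} {xs} x≢b))
                                 (length-filter-≢ b !xs b∈xs))

Irr? : ∀ {Q : ℕ → Set} → Decidable Q → Decidable (Irr Q)
Irr? {Q} Q? y = Q? y ×-dec ¬? (y ℕ.≟ 0) ×-dec ¬? (map′ split→ →split (ℕP.anyUpTo? Split? (suc y)))
  where
  Split : ℕ → Set
  Split y₁ = Q y₁ × Q (y ∸ y₁) × y₁ ≢ 0 × y ∸ y₁ ≢ 0
  Split? : Decidable Split
  Split? y₁ = Q? y₁ ×-dec Q? (y ∸ y₁) ×-dec ¬? (y₁ ℕ.≟ 0) ×-dec ¬? ((y ∸ y₁) ℕ.≟ 0)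
  split→ : (∃ λ y₁ → y₁ < suc y × Split y₁) → ∃₂ λ y₁ y₂ → Q y₁ × Q y₂ × y₁ ≢ 0 × y₂ ≢ 0 × y₁ + y₂ ≡ y
  split→ (y₁ , y₁<1+y , Qy₁ , Qy₂ , y₁≢0 , y₂≢0) =
    y₁ , y ∸ y₁ , Qy₁ , Qy₂ , y₁≢0 , y₂≢0 , ℕP.m+[n∸m]≡n (ℕ.s≤s⁻¹ y₁<1+y)
  →split : (∃₂ λ y₁ y₂ → Q y₁ × Q y₂ × y₁ ≢ 0 × y₂ ≢ 0 × y₁ + y₂ ≡ y) → ∃ λ y₁ → y₁ < suc y × Split y₁
  →split (y₁ , y₂ , Qy₁ , Qy₂ , y₁≢0 , y₂≢0 , refl) = y₁ , s≤s (ℕP.m≤m+n y₁ y₂) , Qy₁ ,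
    subst Q (sym (ℕP.m+n∸m≡n y₁ y₂)) Qy₂ , y₁≢0 , subst (_≢ 0) (sym (ℕP.m+n∸m≡n y₁ y₂)) y₂≢0

Irr-cancel : ∀ {Q : ℕ → Set} {y s} → Irr Q y → Q s → s ≢ 0 → InZ Q (+ y -ᶻ + s) → y ≡ s
Irr-cancel {Q} {y} {s} (_ , _ , indecomposable) Qs s≢0 with + y -ᶻ + s in y-s≡
... | + zero    = λ _ → ℤP.+-injective (ℤP.i-j≡0⇒i≡j (+ y) (+ s) y-s≡)
... | +[1+ n ] = λ Q1+n → contradiction (s , suc n , Qs , Q1+n , s≢0 , (λ ()) , s+1+n≡y) indecomposable
  where
  s+1+n≡y : s + suc n ≡ y
  s+1+n≡y = ℤP.+-injective (trans (ℤP.pos-+ s (suc n)) (trans (cong (+ s +ᶻ_) (sym y-s≡)) (cancel (+ s) (+ y))))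
    where
    cancel : ∀ s y → s +ᶻ (y -ᶻ s) ≡ y
    cancel = solve-∀
... | -[1+ _ ] = λ ()

type≡embDim∸1 : ∀ {Q : ℕ → Set} (Q? : Decidable Q) N b (c : ℤ) →
  (∀ y → Irr Q y → y < N) → Irr Q b →
  (∀ x → PF Q x ⇔ (∃ λ y → Irr Q y × y ≢ b × x ≡ c -ᶻ + y)) →
  Σ ℕ λ t → Σ ℕ λ e → Type Q t × EmbDim Q e × t ≡ e ∸ 1
type≡embDim∸1 {Q} Q? N b c bound b∈Irr PF⇔ = length pfs , length irrs ,
  (pfs , pfs-unique , (λ x → mk⇔ (pf x) (pf⁻¹ x)) , refl) ,
  (irrs , proj₁ irrs-enum , proj₂ irrs-enum , refl) ,
  trans (length-map reflect others) (cong (_∸ 1) (length-filter-≢ b (proj₁ irrs-enum) b∈irrs))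
  where
  irrs : List ℕ
  irrs = filter (Irr? Q?) (upTo N)
  irrs-enum : Enumerates (Irr Q) irrs
  irrs-enum = enumerate-bounded (Irr? Q?) N bound
  b∈irrs : b ∈ irrs
  b∈irrs = Equivalence.from (proj₂ irrs-enum b) b∈Irr
  ≢b? : Decidable (_≢ b)
  ≢b? y = ¬? (y ℕ.≟ b)
  others : List ℕ
  others = filter ≢b? irrs
  reflect : ℕ → ℤ
  reflect y = c -ᶻ + y
  reflect-injective : ∀ {y y'} → reflect y ≡ reflect y' → y ≡ y'
  reflect-injective {y} {y'} c-y≡c-y' = ℤP.+-injective (trans (cancel c (+ y)) (trans (cong (λ z → c -ᶻ z) c-y≡c-y') (sym (cancel c (+ y')))))
    where
    cancel : ∀ c y → y ≡ c -ᶻ (c -ᶻ y)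
    cancel = solve-∀
  pfs : List ℤ
  pfs = map reflect others
  pfs-unique : Unique pfs
  pfs-unique = Unique.map⁺ reflect-injective (Unique.filter⁺ ≢b? {irrs} (proj₁ irrs-enum))
  pf : ∀ x → x ∈ pfs → PF Q x
  pf x x∈ with ∈-map⁻ reflect x∈
  ... | y , y∈ , x≡c-y with ∈-filter⁻ ≢b? {xs = irrs} y∈
  ...   | y∈irrs , y≢b = Equivalence.from (PF⇔ x) (y , Equivalence.to (proj₂ irrs-enum y) y∈irrs , y≢b , x≡c-y)
  pf⁻¹ : ∀ x → PF Q x → x ∈ pfs
  pf⁻¹ x x∈PF with Equivalence.to (PF⇔ x) x∈PF
  ... | y , y∈Irr , y≢b , refl = ∈-map⁺ reflect (∈-filter⁺ ≢b? (Equivalence.from (proj₂ irrs-enum y) y∈Irr) y≢b)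

module Reflection (P : ℕ → Set) (P? : Decidable P) (P0 : P 0) (f : ℕ)
  (reflect : ∀ z → InZ P (+ f -ᶻ z) ⇔ (¬ InZ P z)) where

  f-f-z≡z : ∀ z → + f -ᶻ (+ f -ᶻ z) ≡ z
  f-f-z≡z = cancel (+ f)
    where
    cancel : ∀ f z → f -ᶻ (f -ᶻ z) ≡ z
    cancel = solve-∀

  ∈-if-reflection-∉ : ∀ z → ¬ InZ P (+ f -ᶻ z) → InZ P z
  ∈-if-reflection-∉ z f-z∉P = subst (InZ P) (f-f-z≡z z) (Equivalence.from (reflect (+ f -ᶻ z)) f-z∉P)

  f∉P : ¬ P f
  f∉P Pf = Equivalence.to (reflect 0ℤ) (subst (InZ P) (sym (ℤP.+-identityʳ (+ f))) Pf) P0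

  ∈-above-f : ∀ z → + f <ᶻ z → InZ P z
  ∈-above-f z f<z = ∈-if-reflection-∉ z (λ f-z∈P → negative (f-z<0 f<z) f-z∈P)
    where
    f-z<0 : + f <ᶻ z → + f -ᶻ z <ᶻ 0ℤ
    f-z<0 f<z = subst (+ f -ᶻ z <ᶻ_) (ℤP.+-inverseʳ z) (ℤP.+-monoˡ-< (-ᶻ z) f<z)
    negative : ∀ {w} → w <ᶻ 0ℤ → ¬ InZ P w
    negative { -[1+ _ ]} _      ()
    negative {+ _}       (ℤ.+<+ ()) _

  frobenius : IsFrobenius P (+ f)
  frobenius = f∉P , ∈-above-f

  f∈PF : PF P (+ f)
  f∈PF = f∉P , λ s _ s≢0 → ∈-above-f (+ f +ᶻ + s)
    (subst (+ f <ᶻ_) (ℤP.pos-+ f s) (ℤ.+<+ (ℕP.m<m+n f (ℕP.n≢0⇒n>0 s≢0))))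

  PF⇒≡f : ∀ x → PF P x → x ≡ + f
  PF⇒≡f x (x∉P , x+s∈P) with + f -ᶻ x in f-x≡ | Equivalence.from (reflect x) x∉P
  ... | + zero    | _    = sym (ℤP.i-j≡0⇒i≡j (+ f) x f-x≡)
  ... | +[1+ n ] | P1+n = contradiction (subst (InZ P) x+[f-x]≡f (x+s∈P (suc n) P1+n (λ ()))) f∉P
    where
    x+[f-x]≡f : x +ᶻ +[1+ n ] ≡ + f
    x+[f-x]≡f = trans (cong (x +ᶻ_) (sym f-x≡)) (cancel x (+ f))
      where
      cancel : ∀ x f → x +ᶻ (f -ᶻ x) ≡ f
      cancel = solve-∀

  type-one : Type P 1
  type-one = + f ∷ [] , All.[] ∷ [] ,
    (λ x → mk⇔ (λ { (here refl) → f∈PF }) (λ x∈PF → here (PF⇒≡f x x∈PF))) , refl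

  symmetric : Symmetric P
  symmetric = + f , frobenius , length smalls ,
    (smalls , proj₁ smalls-enum , proj₂ smalls-enum , refl) ,
    (gaps , proj₁ gaps-enum , proj₂ gaps-enum , length-map (f ∸_) smalls)
    where
    Small : ℕ → Set
    Small s = P s × + s <ᶻ + f
    Small? : Decidable Small
    Small? s = P? s ×-dec (+ s ℤP.<? + f)
    smalls : List ℕ
    smalls = filter Small? (upTo f)
    smalls-enum : Enumerates Small smalls
    smalls-enum = enumerate-bounded Small? f (λ _ → ℤP.drop‿+<+ ∘ proj₂)
    small≤f : ∀ {s} → s ∈ smalls → s ≤ f
    small≤f s∈ = ℕP.<⇒≤ (ℤP.drop‿+<+ (proj₂ (Equivalence.to (proj₂ smalls-enum _) s∈)))
    gaps : List ℕ
    gaps = map (f ∸_) smalls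
    gaps-enum : Enumerates (λ x → ¬ P x) gaps
    gaps-enum = map-unique (f ∸_) (λ s∈ t∈ → ℕP.∸-cancelˡ-≡ (small≤f s∈) (small≤f t∈)) (proj₁ smalls-enum) ,
      λ x → mk⇔ (gap x) (gap⁻¹ x)
      where
      gap : ∀ x → x ∈ gaps → ¬ P x
      gap x x∈ with ∈-map⁻ (f ∸_) x∈
      ... | s , s∈ , refl = λ Pf-s → Equivalence.to (reflect (+ s))
        (subst (InZ P) (pos-∸ (small≤f s∈)) Pf-s) (proj₁ (Equivalence.to (proj₂ smalls-enum s) s∈))
      gap⁻¹ : ∀ x → ¬ P x → x ∈ gaps
      gap⁻¹ x x∉P with x ℕ.≤? f
      ... | no x≰f = contradiction (∈-above-f (+ x) (ℤ.+<+ (ℕP.≰⇒> x≰f))) x∉P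
      ... | yes x≤f = subst (_∈ gaps) (ℕP.m∸[m∸n]≡n x≤f)
        (∈-map⁺ (f ∸_) (Equivalence.from (proj₂ smalls-enum (f ∸ x)) (Pf-x , ℤ.+<+ f-x<f)))
        where
        Pf-x : P (f ∸ x)
        Pf-x = subst (InZ P) (sym (pos-∸ x≤f)) (Equivalence.from (reflect (+ x)) x∉P)
        f-x<f : f ∸ x < f
        f-x<f = ℕP.∸-monoʳ-< (ℕP.n≢0⇒n>0 λ { refl → x∉P P0 }) x≤f

module NormalForm (A B : ℕ) .{{_ : NonZero A}} (A⊥B : Coprime A B) where

  1+[A∸1]≡A : suc (A ∸ 1) ≡ A
  1+[A∸1]≡A = trans (cong suc (sym (ℕP.pred[m∸n]≡m∸[1+n] A 0))) (ℕP.suc-pred A)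

  A∸1<A : A ∸ 1 < A
  A∸1<A = subst (A ∸ 1 <_) 1+[A∸1]≡A ℕP.≤-refl

  comb : ℤ → ℕ → ℤ
  comb u v = u *ᶻ + A +ᶻ + v *ᶻ + B

  pos-comb : ∀ m v → + (m * A + v * B) ≡ comb (+ m) v
  pos-comb m v = trans (ℤP.pos-+ (m * A) (v * B)) (cong₂ _+ᶻ_ (ℤP.pos-* m A) (ℤP.pos-* v B))

  bézout : ∃₂ λ α β → α *ᶻ + A +ᶻ β *ᶻ + B ≡ 1ℤ
  bézout with coprime-Bézout A⊥B
  ... | Bézout.+- x y eq = + x , -ᶻ + y , (begin
    + x *ᶻ + A +ᶻ (-ᶻ + y) *ᶻ + B             ≡⟨ cong (λ t → t +ᶻ (-ᶻ + y) *ᶻ + B) eqᶻ ⟨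
    1ℤ +ᶻ + y *ᶻ + B +ᶻ (-ᶻ + y) *ᶻ + B       ≡⟨ cancel (+ y) (+ B) ⟩
    1ℤ                                          ∎)
    where
    open ≡-Reasoning
    eqᶻ : 1ℤ +ᶻ + y *ᶻ + B ≡ + x *ᶻ + A
    eqᶻ = trans (sym (pos-1+* y B)) (trans (cong +_ eq) (ℤP.pos-* x A))
    cancel : ∀ s t → 1ℤ +ᶻ s *ᶻ t +ᶻ (-ᶻ s) *ᶻ t ≡ 1ℤ
    cancel = solve-∀
  ... | Bézout.-+ x y eq = -ᶻ + x , + y , (begin
    (-ᶻ + x) *ᶻ + A +ᶻ + y *ᶻ + B             ≡⟨ cong ((-ᶻ + x) *ᶻ + A +ᶻ_) eqᶻ ⟨
    (-ᶻ + x) *ᶻ + A +ᶻ (1ℤ +ᶻ + x *ᶻ + A)     ≡⟨ cancel (+ x) (+ A) ⟩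
    1ℤ                                          ∎)
    where
    open ≡-Reasoning
    eqᶻ : 1ℤ +ᶻ + x *ᶻ + A ≡ + y *ᶻ + B
    eqᶻ = trans (sym (pos-1+* x A)) (trans (cong +_ eq) (ℤP.pos-* y B))
    cancel : ∀ s t → (-ᶻ s) *ᶻ t +ᶻ (1ℤ +ᶻ s *ᶻ t) ≡ 1ℤ
    cancel = solve-∀

  opaque
    normalForm : ∀ w → Σ ℤ λ u → Σ ℕ λ v → v < A × comb u v ≡ w
    normalForm w with bézout
    ... | α , β , αA+βB≡1 = w *ᶻ α +ᶻ q *ᶻ + B , r , ℤD.n%ℕd<d (w *ᶻ β) A , (begin
      (w *ᶻ α +ᶻ q *ᶻ + B) *ᶻ + A +ᶻ + r *ᶻ + B  ≡⟨ regroup w α q (+ r) (+ A) (+ B) ⟩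
      w *ᶻ α *ᶻ + A +ᶻ (+ r +ᶻ q *ᶻ + A) *ᶻ + B   ≡⟨ cong (λ t → w *ᶻ α *ᶻ + A +ᶻ t *ᶻ + B) (ℤD.a≡a%ℕn+[a/ℕn]*n (w *ᶻ β) A) ⟨
      w *ᶻ α *ᶻ + A +ᶻ w *ᶻ β *ᶻ + B              ≡⟨ factor w α β (+ A) (+ B) ⟩
      w *ᶻ (α *ᶻ + A +ᶻ β *ᶻ + B)                 ≡⟨ cong (w *ᶻ_) αA+βB≡1 ⟩
      w *ᶻ 1ℤ                                     ≡⟨ ℤP.*-identityʳ w ⟩
      w                                           ∎)
      where
      open ≡-Reasoning
      q : ℤ
      q = (w *ᶻ β) ℤD./ℕ A
      r : ℕ
      r = (w *ᶻ β) ℤD.%ℕ A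
      regroup : ∀ w α q r a b → (w *ᶻ α +ᶻ q *ᶻ b) *ᶻ a +ᶻ r *ᶻ b ≡ w *ᶻ α *ᶻ a +ᶻ (r +ᶻ q *ᶻ a) *ᶻ b
      regroup = solve-∀
      factor : ∀ w α β a b → w *ᶻ α *ᶻ a +ᶻ w *ᶻ β *ᶻ b ≡ w *ᶻ (α *ᶻ a +ᶻ β *ᶻ b)
      factor = solve-∀

  coefA : ℤ → ℤ
  coefA w = proj₁ (normalForm w)

  coefB : ℤ → ℕ
  coefB w = proj₁ (proj₂ (normalForm w))

  coefB<A : ∀ w → coefB w < A
  coefB<A w = proj₁ (proj₂ (proj₂ (normalForm w)))

  comb-coef : ∀ w → comb (coefA w) (coefB w) ≡ w
  comb-coef w = proj₂ (proj₂ (proj₂ (normalForm w)))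

  comb-injective : ∀ {u u' v v'} → v < A → v' < A → comb u v ≡ comb u' v' → u ≡ u' × v ≡ v'
  comb-injective {u} {u'} {v} {v'} v<A v'<A eq = u≡u' , v≡v'
    where
    -- A divides B (v - v'), hence v - v', whose absolute value is below A
    open ≡-Reasoning
    B[v-v']≡[u'-u]A : + B *ᶻ (+ v -ᶻ + v') ≡ (u' -ᶻ u) *ᶻ + A
    B[v-v']≡[u'-u]A = begin
      + B *ᶻ (+ v -ᶻ + v')         ≡⟨ expand u (+ v) (+ v') (+ A) (+ B) ⟩
      comb u v -ᶻ comb u v'        ≡⟨ cong (_-ᶻ comb u v') eq ⟩
      comb u' v' -ᶻ comb u v'      ≡⟨ collect u u' (+ v') (+ A) (+ B) ⟩
      (u' -ᶻ u) *ᶻ + A             ∎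
      where
      expand : ∀ u v v' a b → b *ᶻ (v -ᶻ v') ≡ (u *ᶻ a +ᶻ v *ᶻ b) -ᶻ (u *ᶻ a +ᶻ v' *ᶻ b)
      expand = solve-∀
      collect : ∀ u u' v' a b → (u' *ᶻ a +ᶻ v' *ᶻ b) -ᶻ (u *ᶻ a +ᶻ v' *ᶻ b) ≡ (u' -ᶻ u) *ᶻ a
      collect = solve-∀
    A∣v⊖v' : A ∣ ℤ.∣ v ⊖ v' ∣
    A∣v⊖v' = subst (λ t → A ∣ ℤ.∣ t ∣) (ℤP.m-n≡m⊖n v v')
      (ℤCop.coprime-divisor (+ A) (+ B) _ A⊥B (ℤ∣.∣⇒∣ᵤ (ℤ∣.divides (u' -ᶻ u) B[v-v']≡[u'-u]A)))
    v≡v' : v ≡ v'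
    v≡v' = ℤP.+-injective (ℤP.i-j≡0⇒i≡j (+ v) (+ v') (trans (ℤP.m-n≡m⊖n v v')
      (ℤP.∣i∣≡0⇒i≡0 (multiple-below≡0 A∣v⊖v'
        (ℕP.≤-<-trans (ℤP.∣m⊝n∣≤m⊔n v v') (ℕP.⊔-pres-<m v<A v'<A))))))
    u≡u' : u ≡ u'
    u≡u' = ℤP.*-cancelʳ-≡ u u' (+ A) (∙-cancelʳ _ _ _ (subst (λ t → comb u v ≡ comb u' t) (sym v≡v') eq))

  coef-unique : ∀ {w u v} → v < A → comb u v ≡ w → coefA w ≡ u × coefB w ≡ v
  coef-unique {w} v<A eq = comb-injective (coefB<A w) v<A (trans (comb-coef w) (sym eq))

  0≤coefA⇒0≤ : ∀ w → 0ℤ ≤ᶻ coefA w → 0ℤ ≤ᶻ w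
  0≤coefA⇒0≤ w 0≤u = subst (0ℤ ≤ᶻ_) w≡ (ℤ.+≤+ z≤n)
    where
    w≡ : + (ℤ.∣ coefA w ∣ * A + coefB w * B) ≡ w
    w≡ = trans (pos-comb ℤ.∣ coefA w ∣ (coefB w)) (trans (cong (λ u → comb u (coefB w)) (sym (nonneg-pos 0≤u))) (comb-coef w))

  Gen2⇔0≤coefA : ∀ n → Gen2 A B n ⇔ 0ℤ ≤ᶻ coefA (+ n)
  Gen2⇔0≤coefA n = mk⇔ to from
    where
    to : Gen2 A B n → 0ℤ ≤ᶻ coefA (+ n)
    to (x , y , xA+yB≡n) = subst (0ℤ ≤ᶻ_) (sym (proj₁ (coef-unique {u = + (x + y / A * B)} (ℕD.m%n<n y A) comb≡n))) (ℤ.+≤+ z≤n)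
      where
      reduce : ∀ x q r a b → (x + q * b) * a + r * b ≡ x * a + (r + q * a) * b
      reduce = ℕSolver.solve-∀
      comb≡n : comb (+ (x + y / A * B)) (y % A) ≡ + n
      comb≡n = begin
        comb (+ (x + y / A * B)) (y % A)          ≡⟨ pos-comb (x + y / A * B) (y % A) ⟨
        + ((x + y / A * B) * A + y % A * B)       ≡⟨ cong +_ (reduce x (y / A) (y % A) A B) ⟩
        + (x * A + (y % A + y / A * A) * B)       ≡⟨ cong (λ t → + (x * A + t * B)) (ℕD.m≡m%n+[m/n]*n y A) ⟨
        + (x * A + y * B)                         ≡⟨ cong +_ xA+yB≡n ⟩
        + n                                       ∎
        where open ≡-Reasoning
    from : 0ℤ ≤ᶻ coefA (+ n) → Gen2 A B n
    from 0≤u = ℤ.∣ coefA (+ n) ∣ , coefB (+ n) , ℤP.+-injective (begin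
      + (ℤ.∣ coefA (+ n) ∣ * A + coefB (+ n) * B)   ≡⟨ pos-comb ℤ.∣ coefA (+ n) ∣ (coefB (+ n)) ⟩
      comb (+ ℤ.∣ coefA (+ n) ∣) (coefB (+ n))      ≡⟨ cong (λ u → comb u (coefB (+ n))) (nonneg-pos 0≤u) ⟨
      comb (coefA (+ n)) (coefB (+ n))              ≡⟨ comb-coef (+ n) ⟩
      + n                                           ∎)
      where open ≡-Reasoning

  comb-+ : ∀ u₁ v₁ u₂ v₂ → comb (u₁ +ᶻ u₂) (v₁ + v₂) ≡ comb u₁ v₁ +ᶻ comb u₂ v₂
  comb-+ u₁ v₁ u₂ v₂ = trans (cong (λ t → (u₁ +ᶻ u₂) *ᶻ + A +ᶻ t *ᶻ + B) (ℤP.pos-+ v₁ v₂))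
    (regroup u₁ u₂ (+ v₁) (+ v₂) (+ A) (+ B))
    where
    regroup : ∀ u₁ u₂ v₁ v₂ a b → (u₁ +ᶻ u₂) *ᶻ a +ᶻ (v₁ +ᶻ v₂) *ᶻ b ≡ (u₁ *ᶻ a +ᶻ v₁ *ᶻ b) +ᶻ (u₂ *ᶻ a +ᶻ v₂ *ᶻ b)
    regroup = solve-∀

  comb-carry : ∀ u t → comb (u +ᶻ + B) t ≡ comb u (A + t)
  comb-carry u t = trans (regroup u (+ t) (+ A) (+ B)) (cong (λ s → u *ᶻ + A +ᶻ s *ᶻ + B) (sym (ℤP.pos-+ A t)))
    where
    regroup : ∀ u t a b → (u +ᶻ b) *ᶻ a +ᶻ t *ᶻ b ≡ u *ᶻ a +ᶻ (a +ᶻ t) *ᶻ b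
    regroup = solve-∀

  coef-+ : ∀ w₁ w₂ →
      (coefB w₁ + coefB w₂ < A × coefA (w₁ +ᶻ w₂) ≡ coefA w₁ +ᶻ coefA w₂)
    ⊎ (coefB w₁ + coefB w₂ ≡ A + coefB (w₁ +ᶻ w₂) × coefA (w₁ +ᶻ w₂) ≡ coefA w₁ +ᶻ coefA w₂ +ᶻ + B)
  coef-+ w₁ w₂ with coefB w₁ + coefB w₂ ℕ.<? A
  ... | yes v₁+v₂<A = inj₁ (v₁+v₂<A , proj₁ (coef-unique v₁+v₂<A sum))
    where
    sum : comb (coefA w₁ +ᶻ coefA w₂) (coefB w₁ + coefB w₂) ≡ w₁ +ᶻ w₂
    sum = trans (comb-+ (coefA w₁) (coefB w₁) (coefA w₂) (coefB w₂)) (cong₂ _+ᶻ_ (comb-coef w₁) (comb-coef w₂))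
  ... | no v₁+v₂≮A with ℕP.m≤n⇒∃[o]m+o≡n (ℕP.≮⇒≥ v₁+v₂≮A)
  ...   | t , A+t≡v₁+v₂ = inj₂ (trans (sym A+t≡v₁+v₂) (cong (λ s → A + s) (sym (proj₂ unique))) , proj₁ unique)
    where
    t<A : t < A
    t<A = ℕP.+-cancelˡ-< A t A (subst (_< A + A) (sym A+t≡v₁+v₂) (ℕP.+-mono-< (coefB<A w₁) (coefB<A w₂)))
    sum : comb (coefA w₁ +ᶻ coefA w₂ +ᶻ + B) t ≡ w₁ +ᶻ w₂
    sum = begin
      comb (coefA w₁ +ᶻ coefA w₂ +ᶻ + B) t               ≡⟨ comb-carry (coefA w₁ +ᶻ coefA w₂) t ⟩
      comb (coefA w₁ +ᶻ coefA w₂) (A + t)                ≡⟨ cong (comb (coefA w₁ +ᶻ coefA w₂)) A+t≡v₁+v₂ ⟩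
      comb (coefA w₁ +ᶻ coefA w₂) (coefB w₁ + coefB w₂)  ≡⟨ comb-+ (coefA w₁) (coefB w₁) (coefA w₂) (coefB w₂) ⟩
      comb (coefA w₁) (coefB w₁) +ᶻ comb (coefA w₂) (coefB w₂)  ≡⟨ cong₂ _+ᶻ_ (comb-coef w₁) (comb-coef w₂) ⟩
      w₁ +ᶻ w₂                                           ∎
      where open ≡-Reasoning
    unique = coef-unique t<A sum

  coef-reflect : ∀ {W} K → comb K (A ∸ 1) ≡ W → ∀ w →
    coefA (W -ᶻ w) ≡ K -ᶻ coefA w × suc (coefB (W -ᶻ w) + coefB w) ≡ A
  coef-reflect {W} K W≡ w = proj₁ unique ,
    trans (cong suc (trans (cong (_+ v) (proj₂ unique)) (ℕP.m∸n+n≡m v≤A∸1))) 1+[A∸1]≡A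
    where
    open ≡-Reasoning
    v : ℕ
    v = coefB w
    v≤A∸1 : v ≤ A ∸ 1
    v≤A∸1 = ℕ.s≤s⁻¹ (subst (v <_) (sym 1+[A∸1]≡A) (coefB<A w))
    difference : comb (K -ᶻ coefA w) (A ∸ 1 ∸ v) ≡ W -ᶻ w
    difference = begin
      comb (K -ᶻ coefA w) (A ∸ 1 ∸ v)                  ≡⟨ cong (λ t → (K -ᶻ coefA w) *ᶻ + A +ᶻ t *ᶻ + B) (pos-∸ v≤A∸1) ⟩
      (K -ᶻ coefA w) *ᶻ + A +ᶻ (+ (A ∸ 1) -ᶻ + v) *ᶻ + B  ≡⟨ regroup K (coefA w) (+ (A ∸ 1)) (+ v) (+ A) (+ B) ⟩
      comb K (A ∸ 1) -ᶻ comb (coefA w) v               ≡⟨ cong₂ _-ᶻ_ W≡ (comb-coef w) ⟩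
      W -ᶻ w                                           ∎
      where
      regroup : ∀ K u c v a b → (K -ᶻ u) *ᶻ a +ᶻ (c -ᶻ v) *ᶻ b ≡ (K *ᶻ a +ᶻ c *ᶻ b) -ᶻ (u *ᶻ a +ᶻ v *ᶻ b)
      regroup = solve-∀
    unique = coef-unique (ℕP.≤-<-trans (ℕP.m∸n≤m (A ∸ 1) v) A∸1<A) difference

module Quotient (A B d : ℕ) .{{_ : NonZero A}} .{{_ : NonZero d}} (A⊥B : Coprime A B)
  (P : ℕ → Set) (P⇔ : ∀ n → P n ⇔ Gen2 A B (d * n)) where

  open NormalForm A B A⊥B public
  open Equivalence using (to; from)

  α : ℤ → ℤ
  α z = coefA (+ d *ᶻ z)

  β : ℤ → ℕ
  β z = coefB (+ d *ᶻ z)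

  ∈⇔0≤α : ∀ z → InZ P z ⇔ 0ℤ ≤ᶻ α z
  ∈⇔0≤α (+ n)      = subst (λ w → P n ⇔ 0ℤ ≤ᶻ coefA w) (ℤP.pos-* d n) (⇔.trans (P⇔ n) (Gen2⇔0≤coefA (d * n)))
  ∈⇔0≤α -[1+ n ] = mk⇔ (λ ()) λ 0≤α → 0≰pos*neg d n (0≤coefA⇒0≤ (+ d *ᶻ -[1+ n ]) 0≤α)

  P? : Decidable P
  P? n = map′ (from (∈⇔0≤α (+ n))) (to (∈⇔0≤α (+ n))) (0ℤ ℤP.≤? α (+ n))

  P0 : P 0
  P0 = from (P⇔ 0) (0 , 0 , sym (ℕP.*-zeroʳ d))

  α-unique : ∀ {z u v} → v < A → + d *ᶻ z ≡ comb u v → α z ≡ u × β z ≡ v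
  α-unique v<A dz≡ = coef-unique v<A (sym dz≡)

  α-+ : ∀ z₁ z₂ →
      (β z₁ + β z₂ < A × α (z₁ +ᶻ z₂) ≡ α z₁ +ᶻ α z₂)
    ⊎ (β z₁ + β z₂ ≡ A + β (z₁ +ᶻ z₂) × α (z₁ +ᶻ z₂) ≡ α z₁ +ᶻ α z₂ +ᶻ + B)
  α-+ z₁ z₂ = subst (λ w →
      (β z₁ + β z₂ < A × coefA w ≡ α z₁ +ᶻ α z₂)
    ⊎ (β z₁ + β z₂ ≡ A + coefB w × coefA w ≡ α z₁ +ᶻ α z₂ +ᶻ + B))
    (sym (ℤP.*-distribˡ-+ (+ d) z₁ z₂)) (coef-+ (+ d *ᶻ z₁) (+ d *ᶻ z₂))

  α0≡0 : α 0ℤ ≡ 0ℤ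
  α0≡0 = proj₁ (α-unique {u = 0ℤ} (ℕ.>-nonZero⁻¹ A) (zeros (+ d) (+ A) (+ B)))
    where
    zeros : ∀ d a b → d *ᶻ 0ℤ ≡ 0ℤ *ᶻ a +ᶻ 0ℤ *ᶻ b
    zeros = solve-∀

  α-superadditive : ∀ z₁ z₂ → α z₁ +ᶻ α z₂ ≤ᶻ α (z₁ +ᶻ z₂)
  α-superadditive z₁ z₂ with α-+ z₁ z₂
  ... | inj₁ (_ , α-sum) = ℤP.≤-reflexive (sym α-sum)
  ... | inj₂ (_ , α-sum) = subst (α z₁ +ᶻ α z₂ ≤ᶻ_) (sym α-sum) (ℤP.i≤i+j (α z₁ +ᶻ α z₂) (+ B))

  α-reflect : ∀ {C} K → + d *ᶻ C ≡ comb K (A ∸ 1) → ∀ z →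
    α (C -ᶻ z) ≡ K -ᶻ α z × suc (β (C -ᶻ z) + β z) ≡ A
  α-reflect {C} K dC≡ z = subst (λ w → coefA w ≡ K -ᶻ α z × suc (coefB w + β z) ≡ A)
    (distrib (+ d) C z) (coef-reflect K (sym dC≡) (+ d *ᶻ z))
    where
    distrib : ∀ d c z → d *ᶻ c -ᶻ d *ᶻ z ≡ d *ᶻ (c -ᶻ z)
    distrib = solve-∀

  A∈P : P A
  A∈P = from (P⇔ A) (d , 0 , ℕP.+-identityʳ (d * A))

  Irr-d≤α⇒≡A : ∀ {y m} → Irr P y → α (+ y) ≡ + m → d ≤ m → y ≡ A
  Irr-d≤α⇒≡A {y} {m} y∈Irr αy≡m d≤m = Irr-cancel y∈Irr A∈P (ℕ.≢-nonZero⁻¹ A) (from (∈⇔0≤α (+ y -ᶻ + A))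
    (subst (0ℤ ≤ᶻ_) (sym (proj₁ (α-unique (coefB<A (+ d *ᶻ + y)) d[y-A]≡))) (ℤP.i≤j⇒0≤j-i (ℤ.+≤+ d≤m))))
    where
    open ≡-Reasoning
    d[y-A]≡ : + d *ᶻ (+ y -ᶻ + A) ≡ comb (+ m -ᶻ + d) (β (+ y))
    d[y-A]≡ = begin
      + d *ᶻ (+ y -ᶻ + A)                        ≡⟨ distrib (+ d) (+ y) (+ A) ⟩
      + d *ᶻ + y -ᶻ + d *ᶻ + A                    ≡⟨ cong (_-ᶻ + d *ᶻ + A) (comb-coef (+ d *ᶻ + y)) ⟨
      comb (α (+ y)) (β (+ y)) -ᶻ + d *ᶻ + A      ≡⟨ cong (λ u → comb u (β (+ y)) -ᶻ + d *ᶻ + A) αy≡m ⟩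
      comb (+ m) (β (+ y)) -ᶻ + d *ᶻ + A          ≡⟨ regroup (+ m) (+ β (+ y)) (+ d) (+ A) (+ B) ⟩
      comb (+ m -ᶻ + d) (β (+ y))                ∎
      where
      distrib : ∀ d y a → d *ᶻ (y -ᶻ a) ≡ d *ᶻ y -ᶻ d *ᶻ a
      distrib = solve-∀
      regroup : ∀ m v d a b → m *ᶻ a +ᶻ v *ᶻ b -ᶻ d *ᶻ a ≡ (m -ᶻ d) *ᶻ a +ᶻ v *ᶻ b
      regroup = solve-∀

  Irr⇒≤ : ∀ y → Irr P y → y ≤ d * A + A * B
  Irr⇒≤ y y∈Irr = bound ℤ.∣ α (+ y) ∣ (nonneg-pos (to (∈⇔0≤α (+ y)) (proj₁ y∈Irr)))
    where
    bound : ∀ m → α (+ y) ≡ + m → y ≤ d * A + A * B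
    bound m αy≡m with d ℕ.≤? m
    ... | yes d≤m = subst (_≤ d * A + A * B) (sym (Irr-d≤α⇒≡A y∈Irr αy≡m d≤m))
        (ℕP.≤-trans (ℕP.m≤n*m A d) (ℕP.m≤m+n (d * A) (A * B)))
    ... | no d≰m = ℕP.≤-trans (ℕP.m≤n*m y d) (subst (_≤ d * A + A * B) mA+βB≡dy
        (ℕP.+-mono-≤ (ℕP.*-monoˡ-≤ A (ℕP.<⇒≤ (ℕP.≰⇒> d≰m))) (ℕP.*-monoˡ-≤ B (ℕP.<⇒≤ (coefB<A (+ d *ᶻ + y))))))
      where
      mA+βB≡dy : m * A + β (+ y) * B ≡ d * y
      mA+βB≡dy = ℤP.+-injective (begin
        + (m * A + β (+ y) * B)     ≡⟨ pos-comb m (β (+ y)) ⟩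
        comb (+ m) (β (+ y))        ≡⟨ cong (λ u → comb u (β (+ y))) αy≡m ⟨
        comb (α (+ y)) (β (+ y))    ≡⟨ comb-coef (+ d *ᶻ + y) ⟩
        + d *ᶻ + y                  ≡⟨ ℤP.pos-* d y ⟨
        + (d * y)                   ∎)
        where open ≡-Reasoning

  symmetric-by-reflection : ∀ F → + d *ᶻ + F ≡ comb -1ℤ (A ∸ 1) → Symmetric P × Type P 1 × IsFrobenius P (+ F)
  symmetric-by-reflection F dF≡ = symmetric , type-one , frobenius
    where
    reflect : ∀ z → InZ P (+ F -ᶻ z) ⇔ (¬ InZ P z)
    reflect z = mk⇔
      (λ F-z∈P z∈P → 0≤-1-i⇒0≰i (subst (0ℤ ≤ᶻ_) α[F-z]≡ (to (∈⇔0≤α (+ F -ᶻ z)) F-z∈P)) (to (∈⇔0≤α z) z∈P))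
      (λ z∉P → from (∈⇔0≤α (+ F -ᶻ z)) (subst (0ℤ ≤ᶻ_) (sym α[F-z]≡) (0≰i⇒0≤-1-i (z∉P ∘ from (∈⇔0≤α z)))))
      where
      α[F-z]≡ : α (+ F -ᶻ z) ≡ -1ℤ -ᶻ α z
      α[F-z]≡ = proj₁ (α-reflect -1ℤ dF≡ z)
    open Reflection P P? P0 F reflect

  module PseudoFrobenius (d∣A∸1 : d ∣ A ∸ 1) (d<A : d < A) (d⊥B : Coprime d B) (1<B : 1 < B) where

    c : ℕ
    c = (A ∸ 1) * B / d

    dc≡ : + d *ᶻ + c ≡ comb 0ℤ (A ∸ 1)
    dc≡ = begin
      + d *ᶻ + c                ≡⟨ ℤP.pos-* d c ⟨
      + (d * c)                 ≡⟨ cong +_ (ℕD.m*[n/m]≡n (ℕ∣.∣m⇒∣m*n B d∣A∸1)) ⟩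
      + ((A ∸ 1) * B)           ≡⟨ pos-comb 0 (A ∸ 1) ⟩
      comb 0ℤ (A ∸ 1)           ∎
      where open ≡-Reasoning

    α[c-z] : ∀ z → α (+ c -ᶻ z) ≡ -ᶻ α z
    α[c-z] z = trans (proj₁ (α-reflect 0ℤ dc≡ z)) (ℤP.+-identityˡ (-ᶻ α z))

    B≢0 : B ≢ 0
    B≢0 B≡0 = contradiction (subst (1 <_) B≡0 1<B) λ ()

    αB≡0 : α (+ B) ≡ 0ℤ
    αB≡0 = proj₁ (α-unique {u = 0ℤ} d<A (sym (ℤP.+-identityˡ (+ d *ᶻ + B))))

    α≡0⇒∣ : ∀ n → α (+ n) ≡ 0ℤ → d ∣ β (+ n) × B ∣ n
    α≡0⇒∣ n αn≡0 = coprime-divisor d⊥B (divides n (trans (ℕP.*-comm B (β (+ n))) (trans (sym dn≡βB) (ℕP.*-comm d n))))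
                 , coprime-divisor (Cop.sym d⊥B) (divides (β (+ n)) dn≡βB)
      where
      dn≡βB : d * n ≡ β (+ n) * B
      dn≡βB = ℤP.+-injective (begin
        + (d * n)                        ≡⟨ ℤP.pos-* d n ⟩
        + d *ᶻ + n                       ≡⟨ comb-coef (+ d *ᶻ + n) ⟨
        comb (α (+ n)) (β (+ n))         ≡⟨ cong (λ u → comb u (β (+ n))) αn≡0 ⟩
        comb 0ℤ (β (+ n))                ≡⟨ pos-comb 0 (β (+ n)) ⟨
        + (β (+ n) * B)                  ∎)
        where open ≡-Reasoning

    B∈P : P B
    B∈P = from (P⇔ B) (0 , d , refl)

    multiple∈P : ∀ j → P (j * B)
    multiple∈P j = from (P⇔ (j * B)) (0 , j * d , reorder j d B)
      where
      reorder : ∀ j d b → j * d * b ≡ d * (j * b)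
      reorder = ℕSolver.solve-∀

    Irr-multiple≡B : ∀ {y} → Irr P y → B ∣ y → y ≡ B
    Irr-multiple≡B (_ , y≢0 , _)            (divides zero          refl) = contradiction refl y≢0
    Irr-multiple≡B _                         (divides (suc zero)    refl) = ℕP.+-identityʳ B
    Irr-multiple≡B (_ , _ , indecomposable) (divides (suc (suc j)) refl) = contradiction
      (B , suc j * B , B∈P , multiple∈P (suc j) , B≢0 , B≢0 ∘ ℕP.m+n≡0⇒m≡0 B , refl) indecomposable

    B∈Irr : Irr P B
    B∈Irr = B∈P , B≢0 , λ (y₁ , y₂ , Py₁ , Py₂ , y₁≢0 , y₂≢0 , y₁+y₂≡B) →
      let αy₁≡0 : α (+ y₁) ≡ 0ℤ
          αy₁≡0 = ℤP.≤-antisym (begin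
            α (+ y₁)                ≤⟨ ℤP.i≤i+j (α (+ y₁)) (α (+ y₂)) {{ℤ.nonNegative (to (∈⇔0≤α (+ y₂)) Py₂)}} ⟩
            α (+ y₁) +ᶻ α (+ y₂)     ≤⟨ α-superadditive (+ y₁) (+ y₂) ⟩
            α (+ y₁ +ᶻ + y₂)         ≡⟨ cong α (trans (sym (ℤP.pos-+ y₁ y₂)) (cong +_ y₁+y₂≡B)) ⟩
            α (+ B)                  ≡⟨ αB≡0 ⟩
            0ℤ                       ∎) (to (∈⇔0≤α (+ y₁)) Py₁)
      in ℕP.<⇒≱ (subst (y₁ <_) y₁+y₂≡B (ℕP.m<m+n y₁ (ℕP.n≢0⇒n>0 y₂≢0)))
           (ℕ∣.∣⇒≤ {{ℕ.≢-nonZero y₁≢0}} (proj₂ (α≡0⇒∣ y₁ αy₁≡0)))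
      where open ℤP.≤-Reasoning

    α-one-element : ∃ λ s → P s × s ≢ 0 × α (+ s) ≡ 1ℤ × β (+ s) < d
    α-one-element = element (InZ⇒nonneg (-ᶻ u) (from (∈⇔0≤α (-ᶻ u)) (subst (0ℤ ≤ᶻ_) (sym (proj₁ αβ)) (ℤ.+≤+ z≤n))))
      where
      module NF = NormalForm d B d⊥B
      u : ℤ
      u = NF.coefA (-ᶻ + A)
      t : ℕ
      t = NF.coefB (-ᶻ + A)
      d[-u]≡ : + d *ᶻ (-ᶻ u) ≡ comb 1ℤ t
      d[-u]≡ = begin
        + d *ᶻ (-ᶻ u)                             ≡⟨ regroup u (+ d) (+ t) (+ B) ⟩
        -ᶻ (u *ᶻ + d +ᶻ + t *ᶻ + B) +ᶻ + t *ᶻ + B   ≡⟨ cong (λ w → -ᶻ w +ᶻ + t *ᶻ + B) (NF.comb-coef (-ᶻ + A)) ⟩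
        -ᶻ (-ᶻ + A) +ᶻ + t *ᶻ + B                   ≡⟨ cong (_+ᶻ + t *ᶻ + B) (trans (ℤP.neg-involutive (+ A)) (sym (ℤP.*-identityˡ (+ A)))) ⟩
        comb 1ℤ t                                 ∎
        where
        open ≡-Reasoning
        regroup : ∀ u d t b → d *ᶻ (-ᶻ u) ≡ -ᶻ (u *ᶻ d +ᶻ t *ᶻ b) +ᶻ t *ᶻ b
        regroup = solve-∀
      αβ : α (-ᶻ u) ≡ 1ℤ × β (-ᶻ u) ≡ t
      αβ = α-unique (ℕP.<-trans (NF.coefB<A (-ᶻ + A)) d<A) d[-u]≡
      element : (Σ ℕ λ s → -ᶻ u ≡ + s × P s) → ∃ λ s → P s × s ≢ 0 × α (+ s) ≡ 1ℤ × β (+ s) < d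
      element (s , -u≡s , Ps) = s , Ps , (λ { refl → 0≢1 (trans (sym α0≡0) αs≡1) }) , αs≡1 ,
        subst (λ z → β z < d) -u≡s (subst (_< d) (sym (proj₂ αβ)) (NF.coefB<A (-ᶻ + A)))
        where
        αs≡1 : α (+ s) ≡ 1ℤ
        αs≡1 = subst (λ z → α z ≡ 1ℤ) -u≡s (proj₁ αβ)
        0≢1 : 0ℤ ≢ 1ℤ
        0≢1 ()

    Irr⇒PF : ∀ y → Irr P y → y ≢ B → PF P (+ c -ᶻ + y)
    Irr⇒PF y y∈Irr y≢B = c-y∉P , closed
      where
      c-y∉P : ¬ InZ P (+ c -ᶻ + y)
      c-y∉P c-y∈P = y≢B (Irr-multiple≡B y∈Irr (proj₂ (α≡0⇒∣ y αy≡0)))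
        where
        αy≡0 : α (+ y) ≡ 0ℤ
        αy≡0 = ℤP.≤-antisym (0≤-i⇒i≤0 (subst (0ℤ ≤ᶻ_) (α[c-z] (+ y)) (to (∈⇔0≤α (+ c -ᶻ + y)) c-y∈P)))
                            (to (∈⇔0≤α (+ y)) (proj₁ y∈Irr))
      closed : ∀ s → P s → s ≢ 0 → InZ P (+ c -ᶻ + y +ᶻ + s)
      closed s Ps s≢0 = subst (InZ P) (regroup (+ c) (+ y) (+ s)) (from (∈⇔0≤α (+ c -ᶻ (+ y -ᶻ + s))) 0≤α[c-[y-s]])
        where
        regroup : ∀ c y s → c -ᶻ (y -ᶻ s) ≡ c -ᶻ y +ᶻ s
        regroup = solve-∀
        0≤α[c-[y-s]] : 0ℤ ≤ᶻ α (+ c -ᶻ (+ y -ᶻ + s))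
        0≤α[c-[y-s]] with 0ℤ ℤP.≤? α (+ c -ᶻ (+ y -ᶻ + s))
        ... | yes 0≤α = 0≤α
        ... | no 0≰α = contradiction (subst (0ℤ ≤ᶻ_) (sym α≡0) (ℤ.+≤+ z≤n)) 0≰α
          where
          open ≡-Reasoning
          y-s∈P : InZ P (+ y -ᶻ + s)
          y-s∈P = from (∈⇔0≤α (+ y -ᶻ + s)) (0≰-i⇒0≤i (subst (λ i → ¬ 0ℤ ≤ᶻ i) (α[c-z] (+ y -ᶻ + s)) 0≰α))
          α≡0 : α (+ c -ᶻ (+ y -ᶻ + s)) ≡ 0ℤ
          α≡0 = begin
            α (+ c -ᶻ (+ y -ᶻ + s))  ≡⟨ α[c-z] (+ y -ᶻ + s) ⟩
            -ᶻ α (+ y -ᶻ + s)        ≡⟨ cong (λ k → -ᶻ α (+ k -ᶻ + s)) (Irr-cancel y∈Irr Ps s≢0 y-s∈P) ⟩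
            -ᶻ α (+ s -ᶻ + s)        ≡⟨ cong (-ᶻ_ ∘ α) (ℤP.+-inverseʳ (+ s)) ⟩
            -ᶻ α 0ℤ                  ≡⟨ cong -ᶻ_ α0≡0 ⟩
            0ℤ                       ∎

    carry⇒d≤1+β : ∀ y₁ y₂ → α (+ y₁) ≡ 0ℤ → α (+ y₂) ≡ 0ℤ → α (+ (y₁ + y₂)) ≢ 0ℤ →
      α (+ (y₁ + y₂)) ≡ + B × d ≤ suc (β (+ (y₁ + y₂)))
    carry⇒d≤1+β y₁ y₂ αy₁≡0 αy₂≡0 αy≢0 rewrite ℤP.pos-+ y₁ y₂ with α-+ (+ y₁) (+ y₂)
    ... | inj₁ (_ , α-sum) = contradiction (trans α-sum (cong₂ _+ᶻ_ αy₁≡0 αy₂≡0)) αy≢0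
    ... | inj₂ (β₁+β₂≡A+β , α-sum) = trans α-sum (cong₂ (λ u v → u +ᶻ v +ᶻ + B) αy₁≡0 αy₂≡0) ,
          ℕ∣.∣⇒≤ (ℕ∣.∣m+n∣m⇒∣n (subst (d ∣_) A+b≡ d∣A+β) d∣A∸1)
      where
      b : ℕ
      b = β (+ y₁ +ᶻ + y₂)
      d∣A+β : d ∣ A + b
      d∣A+β = subst (d ∣_) β₁+β₂≡A+β (ℕ∣.∣m∣n⇒∣m+n (proj₁ (α≡0⇒∣ y₁ αy₁≡0)) (proj₁ (α≡0⇒∣ y₂ αy₂≡0)))
      A+b≡ : A + b ≡ A ∸ 1 + suc b
      A+b≡ = trans (cong (_+ b) (sym 1+[A∸1]≡A)) (sym (ℕP.+-suc (A ∸ 1) b))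

    α≡-B⇒¬closed : ∀ x → α x ≡ -ᶻ + B → β x + d ≤ A → ¬ (∀ s → P s → s ≢ 0 → InZ P (x +ᶻ + s))
    α≡-B⇒¬closed x αx≡-B βx+d≤A closed = absurd α-one-element
      where
      absurd : (∃ λ s → P s × s ≢ 0 × α (+ s) ≡ 1ℤ × β (+ s) < d) → ⊥
      absurd (s , Ps , s≢0 , αs≡1 , βs<d) = [ no-carry , carry ] (α-+ x (+ s))
        where
        no-carry : β x + β (+ s) < A × α (x +ᶻ + s) ≡ α x +ᶻ α (+ s) → ⊥
        no-carry (_ , α-sum) = 0≰-n+1 1<B
          (subst (0ℤ ≤ᶻ_) (trans α-sum (cong₂ _+ᶻ_ αx≡-B αs≡1)) (to (∈⇔0≤α (x +ᶻ + s)) (closed s Ps s≢0)))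
        carry : β x + β (+ s) ≡ A + β (x +ᶻ + s) × α (x +ᶻ + s) ≡ α x +ᶻ α (+ s) +ᶻ + B → ⊥
        carry (βx+βs≡A+β , _) = ℕP.<⇒≱ (ℕP.<-≤-trans (ℕP.+-monoʳ-< (β x) βs<d) βx+d≤A)
          (subst (A ≤_) (sym βx+βs≡A+β) (ℕP.m≤m+n A (β (x +ᶻ + s))))

    closed⇒α≡0 : ∀ {x yᵢ yⱼ} → (∀ s → P s → s ≢ 0 → InZ P (x +ᶻ + s)) →
      P yᵢ → yᵢ ≢ 0 → P yⱼ → x +ᶻ + yᵢ ≡ + c -ᶻ + yⱼ → α (+ yⱼ) ≡ 0ℤ
    closed⇒α≡0 {x} {yᵢ} {yⱼ} closed Pyᵢ yᵢ≢0 Pyⱼ x+yᵢ≡c-yⱼ = ℤP.≤-antisym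
      (0≤-i⇒i≤0 (subst (0ℤ ≤ᶻ_) (α[c-z] (+ yⱼ)) (to (∈⇔0≤α (+ c -ᶻ + yⱼ)) c-yⱼ∈P)))
      (to (∈⇔0≤α (+ yⱼ)) Pyⱼ)
      where
      c-yⱼ∈P : InZ P (+ c -ᶻ + yⱼ)
      c-yⱼ∈P = subst (InZ P) x+yᵢ≡c-yⱼ (closed yᵢ Pyᵢ yᵢ≢0)

    reflection-indecomposable : ∀ {x} n → (∀ s → P s → s ≢ 0 → InZ P (x +ᶻ + s)) →
      x ≡ + c -ᶻ + n → α (+ n) ≢ 0ℤ → ¬ (∃₂ λ y₁ y₂ → P y₁ × P y₂ × y₁ ≢ 0 × y₂ ≢ 0 × y₁ + y₂ ≡ n)
    reflection-indecomposable {x} _ closed x≡c-n αn≢0 (y₁ , y₂ , Py₁ , Py₂ , y₁≢0 , y₂≢0 , refl) =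
      α≡-B⇒¬closed x αx≡-B βx+d≤A closed
      where
      n : ℕ
      n = y₁ + y₂
      x+yᵢ≡c-yⱼ : ∀ {yᵢ yⱼ} → yᵢ + yⱼ ≡ n → x +ᶻ + yᵢ ≡ + c -ᶻ + yⱼ
      x+yᵢ≡c-yⱼ {yᵢ} {yⱼ} yᵢ+yⱼ≡n = begin
        x +ᶻ + yᵢ                       ≡⟨ cong (_+ᶻ + yᵢ) x≡c-n ⟩
        + c -ᶻ + n +ᶻ + yᵢ               ≡⟨ cong (λ z → + c -ᶻ z +ᶻ + yᵢ) (trans (cong +_ (sym yᵢ+yⱼ≡n)) (ℤP.pos-+ yᵢ yⱼ)) ⟩
        + c -ᶻ (+ yᵢ +ᶻ + yⱼ) +ᶻ + yᵢ    ≡⟨ cancel (+ c) (+ yᵢ) (+ yⱼ) ⟩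
        + c -ᶻ + yⱼ                     ∎
        where
        open ≡-Reasoning
        cancel : ∀ c yᵢ yⱼ → c -ᶻ (yᵢ +ᶻ yⱼ) +ᶻ yᵢ ≡ c -ᶻ yⱼ
        cancel = solve-∀
      carry : α (+ n) ≡ + B × d ≤ suc (β (+ n))
      carry = carry⇒d≤1+β y₁ y₂ (closed⇒α≡0 {x} closed Py₂ y₂≢0 Py₁ (x+yᵢ≡c-yⱼ {y₂} {y₁} (ℕP.+-comm y₂ y₁)))
                                 (closed⇒α≡0 {x} closed Py₁ y₁≢0 Py₂ (x+yᵢ≡c-yⱼ {y₁} {y₂} refl)) αn≢0
      αx≡-B : α x ≡ -ᶻ + B
      αx≡-B = trans (cong α x≡c-n) (trans (α[c-z] (+ n)) (cong -ᶻ_ (proj₁ carry)))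
      βx+d≤A : β x + d ≤ A
      βx+d≤A = begin
        β x + d                         ≤⟨ ℕP.+-monoʳ-≤ (β x) (proj₂ carry) ⟩
        β x + suc (β (+ n))             ≡⟨ ℕP.+-suc (β x) (β (+ n)) ⟩
        suc (β x + β (+ n))             ≡⟨ cong (λ z → suc (β z + β (+ n))) x≡c-n ⟩
        suc (β (+ c -ᶻ + n) + β (+ n))  ≡⟨ proj₂ (α-reflect 0ℤ dc≡ (+ n)) ⟩
        A                               ∎
        where open ℕP.≤-Reasoning

    PF⇒Irr : ∀ x → PF P x → ∃ λ y → Irr P y × y ≢ B × x ≡ + c -ᶻ + y
    PF⇒Irr x (x∉P , closed) = reflection (InZ⇒nonneg (+ c -ᶻ x) c-x∈P)
      where
      -αx>0 : ∃ λ k → -ᶻ α x ≡ +[1+ k ]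
      -αx>0 = 0≰i⇒-i≡1+k (x∉P ∘ from (∈⇔0≤α x))
      α[c-x]>0 : α (+ c -ᶻ x) ≡ +[1+ proj₁ -αx>0 ]
      α[c-x]>0 = trans (α[c-z] x) (proj₂ -αx>0)
      c-x∈P : InZ P (+ c -ᶻ x)
      c-x∈P = from (∈⇔0≤α (+ c -ᶻ x)) (subst (0ℤ ≤ᶻ_) (sym α[c-x]>0) (ℤ.+≤+ z≤n))
      reflection : (Σ ℕ λ n → + c -ᶻ x ≡ + n × P n) → ∃ λ y → Irr P y × y ≢ B × x ≡ + c -ᶻ + y
      reflection (n , c-x≡n , Pn) =
        n , (Pn , ≢n α0≡0 ∘ cong +_ ∘ sym , reflection-indecomposable n closed x≡c-n (λ αn≡0 → ≢n αn≡0 refl)) ,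
        ≢n αB≡0 ∘ cong +_ ∘ sym , x≡c-n
        where
        ≢n : ∀ {z} → α z ≡ 0ℤ → z ≢ + n
        ≢n αz≡0 refl = contradiction (trans (sym αz≡0) (subst (λ z → α z ≡ +[1+ proj₁ -αx>0 ]) c-x≡n α[c-x]>0)) λ ()
        x≡c-n : x ≡ + c -ᶻ + n
        x≡c-n = trans (sym (cancel (+ c) x)) (cong (λ z → + c -ᶻ z) c-x≡n)
          where
          cancel : ∀ c x → c -ᶻ (c -ᶻ x) ≡ x
          cancel = solve-∀

    PF⇔ : ∀ x → PF P x ⇔ (∃ λ y → Irr P y × y ≢ B × x ≡ + c -ᶻ + y)
    PF⇔ x = mk⇔ (PF⇒Irr x) λ { (y , y∈Irr , y≢B , refl) → Irr⇒PF y y∈Irr y≢B }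

  pseudo-Frobenius : d ∣ A ∸ 1 → d < A → Coprime d B → 1 < B →
      (∀ x → PF P x ⇔ (∃ λ y → Irr P y × y ≢ B × x ≡ + ((A ∸ 1) * B / d) -ᶻ + y))
    × Σ ℕ λ t → Σ ℕ λ e → Type P t × EmbDim P e × t ≡ e ∸ 1
  pseudo-Frobenius d∣A∸1 d<A d⊥B 1<B =
    PF⇔ , type≡embDim∸1 P? (suc (d * A + A * B)) B (+ c) (λ y → s≤s ∘ Irr⇒≤ y) B∈Irr PF⇔
    where open PseudoFrobenius d∣A∸1 d<A d⊥B 1<B

%≡%⇒∣∸ : ∀ {d} .{{_ : NonZero d}} {m n} → n ≤ m → m % d ≡ n % d → d ∣ m ∸ n
%≡%⇒∣∸ {d} {m} {n} n≤m m%d≡n%d = divides (m / d ∸ n / d) (begin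
  m ∸ n                                        ≡⟨ cong₂ _∸_ (ℕD.m≡m%n+[m/n]*n m d) (ℕD.m≡m%n+[m/n]*n n d) ⟩
  (m % d + m / d * d) ∸ (n % d + n / d * d)    ≡⟨ cong (λ r → (r + m / d * d) ∸ (n % d + n / d * d)) m%d≡n%d ⟩
  (n % d + m / d * d) ∸ (n % d + n / d * d)    ≡⟨ ℕP.[m+n]∸[m+o]≡n∸o (n % d) (m / d * d) (n / d * d) ⟩
  m / d * d ∸ n / d * d                        ≡⟨ ℕP.*-distribʳ-∸ d (m / d) (n / d) ⟨
  (m / d ∸ n / d) * d                          ∎)
  where open ≡-Reasoning

∣∸1⇒< : ∀ {d n} → 1 < n → d ∣ n ∸ 1 → d < n
∣∸1⇒< (s≤s (s≤s _)) d∣n∸1 = s≤s (ℕ∣.∣⇒≤ d∣n∸1)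

frobenius-number : ∀ {a b} → 1 < a → 1 < b →
  a * b ∸ a ∸ b ≡ (a ∸ 1) * (b ∸ 1) ∸ 1 × + (a * b ∸ a ∸ b) ≡ -1ℤ *ᶻ + a +ᶻ + (a ∸ 1) *ᶻ + b
frobenius-number {suc (suc x)} {suc (suc y)} (s≤s (s≤s _)) (s≤s (s≤s _)) = F≡ , trans (cong +_ F≡) (begin
  + (y + x * suc y)          ≡⟨ ℤP.pos-+ y (x * suc y) ⟩
  + y +ᶻ + (x * suc y)       ≡⟨ cong (+ y +ᶻ_) (ℤP.pos-* x (suc y)) ⟩
  + y +ᶻ + x *ᶻ + suc y      ≡⟨ expand (+ x) (+ y) ⟩
  -1ℤ *ᶻ + suc (suc x) +ᶻ + suc x *ᶻ + suc (suc y) ∎)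
  where
  open ≡-Reasoning
  a b K : ℕ
  a = suc (suc x)
  b = suc (suc y)
  K = y + x * suc y
  regroup : ∀ x y → suc (suc x) * suc (suc y) ≡ (y + x * suc y) + suc (suc y) + suc (suc x)
  regroup = ℕSolver.solve-∀
  F≡ : a * b ∸ a ∸ b ≡ K
  F≡ = trans (cong (λ m → m ∸ a ∸ b) (regroup x y))
             (trans (cong (_∸ b) (ℕP.m+n∸n≡m (K + b) a)) (ℕP.m+n∸n≡m K b))
  expand : ∀ x y → y +ᶻ x *ᶻ (1ℤ +ᶻ y) ≡ -1ℤ *ᶻ (1ℤ +ᶻ (1ℤ +ᶻ x)) +ᶻ (1ℤ +ᶻ x) *ᶻ (1ℤ +ᶻ (1ℤ +ᶻ y))
  expand = solve-∀

Gen2-swap : ∀ {a b n} → Gen2 a b n ⇔ Gen2 b a n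
Gen2-swap = mk⇔ swap swap
  where
  swap : ∀ {a b n} → Gen2 a b n → Gen2 b a n
  swap {a} {b} (x , y , xa+yb≡n) = y , x , trans (ℕP.+-comm (y * b) (x * a)) xa+yb≡n

sylvester : ∀ {a b} .{{_ : NonZero a}} → Coprime a b → 1 < a → 1 < b → IsFrobenius (Gen2 a b) (+ (a * b ∸ a ∸ b))
sylvester {a} {b} a⊥b 1<a 1<b = proj₂ (proj₂ (⟨a,b⟩.symmetric-by-reflection (a * b ∸ a ∸ b)
  (trans (ℤP.*-identityˡ (+ (a * b ∸ a ∸ b))) (proj₂ (frobenius-number 1<a 1<b)))))
  where
  module ⟨a,b⟩ = Quotient a b 1 a⊥b (Gen2 a b) (λ n → subst (λ m → Gen2 a b n ⇔ Gen2 a b m) (sym (ℕP.*-identityˡ n)) ⇔.refl)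

theorem6 : (a b d : ℕ) → 0 < a → 0 < b → .{{_ : NonZero d}} →
    Coprime a b → Coprime a d → Coprime b d →
    ¬ Gen2 a b d → a < b →
    ((a ∸ 1) * (b ∸ 1) % d ≡ 1 % d →
      Symmetric (Quot (Gen2 a b) d) × Type (Quot (Gen2 a b) d) 1 ×
      Σ ℤ (λ f → IsFrobenius (Quot (Gen2 a b) d) f ×
        IsFrobenius (Gen2 a b) (+ (a * b ∸ a ∸ b)) ×
        f ≡ + ((a * b ∸ a ∸ b) / d)))
    × (a % d ≡ 1 % d →
      (∀ x → PF (Quot (Gen2 a b) d) x ⇔
        ∃ (λ y → Irr (Quot (Gen2 a b) d) y × y ≢ b × x ≡ + ((a ∸ 1) * b / d) ℤ.- + y))
      × Σ ℕ (λ t → Σ ℕ (λ e → Type (Quot (Gen2 a b) d) t × EmbDim (Quot (Gen2 a b) d) e × t ≡ e ∸ 1)))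
    × (b % d ≡ 1 % d →
      (∀ x → PF (Quot (Gen2 a b) d) x ⇔
        ∃ (λ y → Irr (Quot (Gen2 a b) d) y × y ≢ a × x ≡ + ((b ∸ 1) * a / d) ℤ.- + y))
      × Σ ℕ (λ t → Σ ℕ (λ e → Type (Quot (Gen2 a b) d) t × EmbDim (Quot (Gen2 a b) d) e × t ≡ e ∸ 1)))
theorem6 (suc zero) _ d _ _ _ _ _ d∉⟨1,b⟩ _ =
  contradiction (d , 0 , trans (ℕP.+-identityʳ (d * 1)) (ℕP.*-identityʳ d)) d∉⟨1,b⟩
theorem6 a@(suc (suc _)) b d _ 0<b a⊥b a⊥d b⊥d _ a<b =
  (λ ab%d≡1 → let symmetric , type-one , frobenius = S.symmetric-by-reflection (F / d) (dF/d≡ ab%d≡1)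
              in symmetric , type-one , + (F / d) , frobenius , sylvester a⊥b 1<a 1<b , refl) ,
  (λ a%d≡1 → let d∣a∸1 = %≡%⇒∣∸ 0<a a%d≡1
             in S.pseudo-Frobenius d∣a∸1 (∣∸1⇒< 1<a d∣a∸1) (Cop.sym b⊥d) 1<b) ,
  (λ b%d≡1 → let d∣b∸1 = %≡%⇒∣∸ 0<b b%d≡1
             in Sᵀ.pseudo-Frobenius d∣b∸1 (∣∸1⇒< 1<b d∣b∸1) (Cop.sym a⊥d) 1<a)
  where
  0<a : 0 < a
  0<a = s≤s z≤n
  1<a : 1 < a
  1<a = s≤s (s≤s z≤n)
  1<b : 1 < b
  1<b = ℕP.<-trans 1<a a<b
  S : ℕ → Set
  S = Quot (Gen2 a b) d
  module S = Quotient a b d a⊥b S (λ _ → ⇔.refl)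
  module Sᵀ = Quotient b a d {{ℕ.>-nonZero 0<b}} (Cop.sym a⊥b) S (λ _ → Gen2-swap)
  F : ℕ
  F = a * b ∸ a ∸ b
  dF/d≡ : (a ∸ 1) * (b ∸ 1) % d ≡ 1 % d → + d *ᶻ + (F / d) ≡ S.comb -1ℤ (a ∸ 1)
  dF/d≡ ab%d≡1 = trans (sym (ℤP.pos-* d (F / d)))
    (trans (cong +_ (ℕD.m*[n/m]≡n d∣F)) (proj₂ (frobenius-number 1<a 1<b)))
    where
    d∣F : d ∣ F
    d∣F = subst (d ∣_) (sym (proj₁ (frobenius-number 1<a 1<b)))
      (%≡%⇒∣∸ (ℕP.*-mono-≤ {1} {a ∸ 1} {1} {b ∸ 1} (s≤s z≤n) (ℕP.∸-monoˡ-≤ 1 1<b)) ab%d≡1)
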